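{- Let $n\geq 2$ and let $\pi\in\mathcal{S}_n$ be irreducible with both $\pi$ and $\hat\pi=\theta(\pi)$ avoiding $321$. Then either $\hat\pi_n=n-1$ (equivalently $\pi_{n-1}=n$), or $\hat\pi_{n-1}\hat\pi_n=n\,i$ (equivalently $\pi_n=i$ and $\pi_i=n$) for some $i$ with $\lceil n/2\rceil\leq i\leq n-2$.
   Context: $\mathcal{S}_n$ is the symmetric group on $[n]$, permutations in one-line notation $\pi_1\cdots\pi_n$. A permutation avoids a pattern $\tau$ if it has no subsequence order-isomorphic to $\tau$. The standard cycle notation of $\pi$ writes each cycle (fixed points included) with its largest element first and orders cycles by increasing largest element. The fundamental bijection $\theta:\mathcal{S}_n\to\mathcal{S}_n$ maps $\pi$ to the permutation whose one-line notation is obtained by erasing the parentheses of the standard cycle notation of $\pi$. For $\pi\in\mathcal{S}_n$, $\tau\in\mathcal{S}_m$, the direct sum $\pi\oplus\tau\in\mathcal{S}_{n+m}$ is $\pi(i)$ for $i\le n$ and $\tau(i-n)+n$ for $i>n$. A permutation is reducible if it equals $\sigma\oplus\tau$ with both $\sigma,\tau$ nonempty, and irreducible otherwise. -}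

module Defs where

open import Data.Nat using (ℕ; zero; suc; _+_; _∸_; _<_; _≤ᵇ_; _≡ᵇ_)
open import Data.Bool using (Bool; true; false; if_then_else_)
open import Data.List using (List; []; _∷_; _++_; map; upTo; length; concatMap)
open import Data.List.Relation.Binary.Permutation.Propositional using (_↭_)
open import Data.List.Relation.Binary.Sublist.Propositional using (_⊆_)
open import Data.Product using (Σ; ∃; _×_)
open import Relation.Binary.PropositionalEquality using (_≡_)
open import Relation.Nullary using (¬_)

-- Permutations of [n] = {1,...,n} in one-line notation: a list of naturals
-- (1-based values) that is a rearrangement of 1,2,...,n.
oneToN : ℕ → List ℕ
oneToN n = map suc (upTo n)

IsPerm : ℕ → List ℕ → Set
IsPerm n l = l ↭ oneToN n

-- 1-based entry: at l i = l_i  (0 outside the range 1..length l).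
at : List ℕ → ℕ → ℕ
at []      _             = 0
at (a ∷ l) zero          = 0
at (a ∷ l) (suc zero)    = a
at (a ∷ l) (suc (suc k)) = at l (suc k)

Contains321 : List ℕ → Set
Contains321 l = Σ ℕ λ a → Σ ℕ λ b → Σ ℕ λ c →
  ((a ∷ b ∷ c ∷ []) ⊆ l) × (b < a) × (c < b)

Avoids321 : List ℕ → Set
Avoids321 l = ¬ Contains321 l

_⊕_ : List ℕ → List ℕ → List ℕ
σ ⊕ τ = σ ++ map (λ x → x + length σ) τ

Reducible : List ℕ → Set
Reducible l = Σ (List ℕ) λ σ → Σ (List ℕ) λ τ →
  IsPerm (length σ) σ × IsPerm (length τ) τ ×
  ¬ (σ ≡ []) × ¬ (τ ≡ []) × (l ≡ σ ⊕ τ)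

Irreducible : List ℕ → Set
Irreducible l = ¬ Reducible l

-- The cycle of the permutation l through m, written starting at m:
-- m, l(m), l(l(m)), ... until returning to m (fuel = length l suffices).
cycleFrom : List ℕ → ℕ → List ℕ
cycleFrom l m = m ∷ go (length l) (at l m)
  where
  go : ℕ → ℕ → List ℕ
  go zero    _ = []
  go (suc k) x = if x ≡ᵇ m then [] else x ∷ go k (at l x)

isCycleMax : List ℕ → ℕ → Bool
isCycleMax l m = allLe (cycleFrom l m)
  where
  allLe : List ℕ → Bool
  allLe []      = true
  allLe (x ∷ xs) = if x ≤ᵇ m then allLe xs else false

-- θ(l): standard cycle notation (each cycle starting with its largest
-- element, cycles in increasing order of largest element), parentheses erased.
θ : List ℕ → List ℕ
θ l = concatMap (λ m → if isCycleMax l m then cycleFrom l m else []) (oneToN (length l))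

{-# OPTIONS --safe #-}
-- The last block of θ(π) is the cycle of n, written n, π(n), π²(n), …, y with π(y) = n
-- (irreducibility gives π(n) ≠ n). As θ(π) avoids 321, the block is increasing after n,
-- so y is its largest entry below n. If y = n - 1 we are in the first case. If the cycle
-- is (n y), then 321-avoidance of π gives π(y+1) < π(y+2) < … < π(n) because π(y) = n,
-- so y = π(n) ≥ n - y. Otherwise the cycle continues n → c₁ → c₂ with c₁ < c₂ < n - 1,
-- so n - 1 lies in another cycle, whose block n - 1, …, d (π(d) = n - 1) stands just
-- before that of n. Every position of d is fatal: d = n - 1 gives n, n - 1, c₁ at
-- positions y < n - 1 < n of π; d < c₁ gives n - 1, c₂, c₁ at positions d < c₁ < n
-- of π; and d > c₁ gives the subsequence n - 1, d, c₁ of θ(π).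
module Submission where

open import Defs
open import Data.Bool using (Bool; true; false; if_then_else_; T)
open import Data.Bool.Properties using (T-≡)
open import Data.Empty using (⊥; ⊥-elim)
open import Data.List using (List; []; _∷_; _++_; [_]; length; map; upTo; concatMap; initLast; _∷ʳ′_)
open import Data.List.Properties
  using (upTo-∷ʳ; map-++; ++-assoc; ++-identityʳ; concatMap-++; length-map; length-upTo; length-++)
open import Data.List.Membership.Propositional using (_∈_; _∉_)
open import Data.List.Membership.Propositional.Properties using (∈-map⁻; ∈-upTo⁻; ∈-++⁺ʳ)
open import Data.List.Relation.Unary.Any using (here; there)
open import Data.List.Relation.Unary.All as All using (All; []; _∷_)
open import Data.List.Relation.Unary.AllPairs using (_∷_)
open import Data.List.Relation.Unary.Unique.Propositional using (Unique)
open import Data.List.Relation.Unary.Unique.Propositional.Properties using (map⁺; upTo⁺)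
open import Data.List.Relation.Binary.Permutation.Propositional using (_↭_; ↭-refl; ↭-sym; ↭⇒↭ₛ)
open import Data.List.Relation.Binary.Permutation.Propositional.Properties
  using (∈-resp-↭; ↭-length; drop-mid)
open import Data.List.Relation.Binary.Permutation.Setoid.Properties using (Unique-resp-↭)
open import Data.List.Relation.Binary.Sublist.Propositional
  using (_⊆_; _∷_; _∷ʳ_; ⊆-refl; ⊆-trans; lookup; from∈; minimum)
open import Data.List.Relation.Binary.Sublist.Propositional.Properties using (++⁺ˡ; ++⁺ʳ; ++⁺)
open import Data.Nat using (ℕ; zero; suc; _+_; _∸_; _≤_; _<_; z≤n; s≤s; _≡ᵇ_; _≤ᵇ_; ⌈_/2⌉)
open import Data.Nat.Properties
open import Data.Product using (Σ; ∃₂; _×_; _,_; proj₁; proj₂)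
open import Data.Sum using (_⊎_; inj₁; inj₂)
open import Function using (_∘_; Equivalence)
open import Relation.Binary.Definitions using (Tri; tri<; tri≈; tri>)
open import Relation.Binary.PropositionalEquality
  using (_≡_; _≢_; refl; sym; trans; cong; cong₂; subst; subst₂; setoid; module ≡-Reasoning)
open import Relation.Nullary using (¬_; yes; no)

InRange : ℕ → ℕ → Set
InRange n p = 1 ≤ p × p ≤ n

∈-oneToN⁻ : ∀ {n x} → x ∈ oneToN n → InRange n x
∈-oneToN⁻ x∈ with ∈-map⁻ suc x∈
... | _ , y∈ , refl = s≤s z≤n , ∈-upTo⁻ y∈

oneToN-suc : ∀ k → oneToN (suc k) ≡ oneToN k ++ [ suc k ]
oneToN-suc k = trans (cong (map suc) (sym (upTo-∷ʳ k))) (map-++ suc (upTo k) [ k ])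

at-∈ : ∀ (l : List ℕ) {p} → InRange (length l) p → at l p ∈ l
at-∈ (a ∷ l) {suc zero}    _             = here refl
at-∈ (a ∷ l) {suc (suc p)} (_ , s≤s p≤) = there (at-∈ l (s≤s z≤n , p≤))

at-injective : ∀ {l : List ℕ} → Unique l → ∀ {p q} →
  InRange (length l) p → InRange (length l) q → at l p ≡ at l q → p ≡ q
at-injective {a ∷ l} _ {suc zero} {suc zero} _ _ _ = refl
at-injective {a ∷ l} (a∉ ∷ _) {suc zero} {suc (suc q)} _ (_ , s≤s q≤) e =
  ⊥-elim (All.lookup a∉ (at-∈ l (s≤s z≤n , q≤)) e)
at-injective {a ∷ l} (a∉ ∷ _) {suc (suc p)} {suc zero} (_ , s≤s p≤) _ e =
  ⊥-elim (All.lookup a∉ (at-∈ l (s≤s z≤n , p≤)) (sym e))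
at-injective {a ∷ l} (_ ∷ u) {suc (suc p)} {suc (suc q)} (_ , s≤s p≤) (_ , s≤s q≤) e =
  cong suc (at-injective u (s≤s z≤n , p≤) (s≤s z≤n , q≤) e)

at-⊆₂ : ∀ (l : List ℕ) {p q} → 1 ≤ p → p < q → q ≤ length l →
  (at l p ∷ at l q ∷ []) ⊆ l
at-⊆₂ (a ∷ l) {suc zero}    {suc (suc q)} _ _         (s≤s q≤) =
  refl ∷ from∈ (at-∈ l (s≤s z≤n , q≤))
at-⊆₂ (a ∷ l) {suc (suc p)} {suc (suc q)} _ (s≤s p<q) (s≤s q≤) =
  a ∷ʳ at-⊆₂ l (s≤s z≤n) p<q q≤
at-⊆₂ (a ∷ l) {suc zero}    {suc zero}    _ (s≤s ())  _

at-⊆₃ : ∀ (l : List ℕ) {p q r} → 1 ≤ p → p < q → q < r → r ≤ length l →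
  (at l p ∷ at l q ∷ at l r ∷ []) ⊆ l
at-⊆₃ (a ∷ l) {suc zero}    {suc (suc q)} {suc (suc r)} _ _ (s≤s q<r) (s≤s r≤) =
  refl ∷ at-⊆₂ l (s≤s z≤n) q<r r≤
at-⊆₃ (a ∷ l) {suc (suc p)} {suc (suc q)} {suc (suc r)}
      _ (s≤s p<q) (s≤s q<r) (s≤s r≤) =
  a ∷ʳ at-⊆₃ l (s≤s z≤n) p<q q<r r≤
at-⊆₃ (a ∷ l) {suc zero} {suc zero} _ (s≤s ()) _ _

length-∷ʳ : ∀ (σ : List ℕ) a → length (σ ++ [ a ]) ≡ suc (length σ)
length-∷ʳ σ a = trans (length-++ σ) (+-comm (length σ) 1)

at-last : ∀ (σ : List ℕ) a → at (σ ++ [ a ]) (suc (length σ)) ≡ a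
at-last []      a = refl
at-last (_ ∷ σ) a = at-last σ a

Avoids21 : List ℕ → Set
Avoids21 l = ∀ {a b} → (a ∷ b ∷ []) ⊆ l → ¬ b < a

Avoids21-tail : ∀ {x xs} → Avoids21 (x ∷ xs) → Avoids21 xs
Avoids21-tail asc s = asc (_ ∷ʳ s)

Avoids21-head : ∀ {x y xs} → Avoids21 (x ∷ y ∷ xs) → x ≤ y
Avoids21-head asc = ≮⇒≥ (asc (refl ∷ from∈ (here refl)))

Avoids21-last-max : ∀ pre {y} → Avoids21 (pre ++ [ y ]) → All (_≤ y) (pre ++ [ y ])
Avoids21-last-max []        asc = ≤-refl ∷ []
Avoids21-last-max (a ∷ pre) asc =
  ≮⇒≥ (asc (refl ∷ ++⁺ˡ pre ⊆-refl)) ∷ Avoids21-last-max pre (Avoids21-tail asc)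

Avoids321⇒Avoids21 : ∀ {l c xs} → Avoids321 l → (c ∷ xs) ⊆ l → All (_< c) xs → Avoids21 xs
Avoids321⇒Avoids21 av c∷xs⊆l below s b<a =
  av (_ , _ , _ , ⊆-trans (refl ∷ s) c∷xs⊆l , All.lookup below (lookup s (here refl)) , b<a)

module _ {n : ℕ} {π : List ℕ} (P : IsPerm n π) where

  IsPerm-length : length π ≡ n
  IsPerm-length = trans (↭-length P) (trans (length-map suc (upTo n)) (length-upTo n))

  private
    InRange-length : ∀ {p} → InRange n p → InRange (length π) p
    InRange-length {p} = subst (λ k → InRange k p) (sym IsPerm-length)

  IsPerm-at-InRange : ∀ {p} → InRange n p → InRange n (at π p)
  IsPerm-at-InRange = ∈-oneToN⁻ ∘ ∈-resp-↭ P ∘ at-∈ π ∘ InRange-length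

  IsPerm-at-injective : ∀ {p q} → InRange n p → InRange n q → at π p ≡ at π q → p ≡ q
  IsPerm-at-injective p∈ q∈ = at-injective unique (InRange-length p∈) (InRange-length q∈)
    where
    unique : Unique π
    unique = Unique-resp-↭ (setoid ℕ) (↭⇒↭ₛ (↭-sym P)) (map⁺ suc-injective (upTo⁺ n))

  Avoids321-at : Avoids321 π → ∀ {p q r} → 1 ≤ p → p < q → q < r → r ≤ n →
    at π q < at π p → at π r < at π q → ⊥
  Avoids321-at av 1≤p p<q q<r r≤n πq<πp πr<πq =
    av (_ , _ , _ , at-⊆₃ π 1≤p p<q q<r r≤|π| , πq<πp , πr<πq)
    where
    r≤|π| : _ ≤ length π
    r≤|π| = subst (_ ≤_) (sym IsPerm-length) r≤n

-- `cycleFrom` and `isCycleMax` are defined through local functions, which cannot be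
-- referred to directly. The metas `walk` and `allBelow` are solved by unification in
-- the two with-abstractions, so they are exactly those local functions.
mutual
  walk : List ℕ → ℕ → ℕ → ℕ → List ℕ
  walk = _

  cycleFrom-walk : ∀ l m → cycleFrom l m ≡ m ∷ walk l m (length l) (at l m)
  cycleFrom-walk l m with length l | at l m
  ... | _ | _ = refl

mutual
  allBelow : List ℕ → ℕ → List ℕ → Bool
  allBelow = _

  isCycleMax-allBelow : ∀ l m →
    isCycleMax l m ≡ (if m ≤ᵇ m then allBelow l m (walk l m (length l) (at l m)) else false)
  isCycleMax-allBelow l m with walk l m (length l) (at l m)
  ... | _ = refl

T⇒≡true : ∀ {b} → T b → b ≡ true
T⇒≡true = Equivalence.to T-≡

allBelow-true : ∀ l m {xs} → All (_≤ m) xs → allBelow l m xs ≡ true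
allBelow-true l m []            = refl
allBelow-true l m (x≤m ∷ xs≤m) rewrite T⇒≡true (≤⇒≤ᵇ x≤m) = allBelow-true l m xs≤m

isCycleMax-true : ∀ l m → All (_≤ m) (walk l m (length l) (at l m)) →
  isCycleMax l m ≡ true
isCycleMax-true l m below
  rewrite isCycleMax-allBelow l m | T⇒≡true (≤⇒≤ᵇ (≤-refl {m})) = allBelow-true l m below

module _ (l : List ℕ) (m : ℕ) where

  walk-≡ : ∀ k {x} → x ≡ m → walk l m k x ≡ []
  walk-≡ zero        _   = refl
  walk-≡ (suc k) {x} x≡m with x ≡ᵇ m in eq
  ... | true  = refl
  ... | false = ⊥-elim (subst T eq (≡⇒≡ᵇ x m x≡m))

  walk-≢ : ∀ k {x} → x ≢ m → walk l m (suc k) x ≡ x ∷ walk l m k (at l x)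
  walk-≢ k {x} x≢m with x ≡ᵇ m in eq
  ... | true  = ⊥-elim (x≢m (≡ᵇ⇒≡ x m (subst T (sym eq) _)))
  ... | false = refl

  walk-∷⁻ : ∀ k {x a r} → walk l m k x ≡ a ∷ r →
    a ≡ x × Σ ℕ λ k′ → r ≡ walk l m k′ (at l x)
  walk-∷⁻ (suc k) {x} eq with x ≡ᵇ m
  walk-∷⁻ (suc k) refl | false = refl , k , refl

  walk-All : (R : ℕ → Set) → (∀ {z} → R z → R (at l z)) →
    ∀ k {x} → R x → All (λ z → R z × z ≢ m) (walk l m k x)
  walk-All R R-closed zero    Rx = []
  walk-All R R-closed (suc k) {x} Rx with x ≟ m
  ... | yes x≡m rewrite walk-≡ (suc k) x≡m = []
  ... | no  x≢m rewrite walk-≢ k x≢m = (Rx , x≢m) ∷ walk-All R R-closed k (R-closed Rx)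

  walk-∈⁻ : ∀ k {x s} → s ∈ walk l m k x →
    s ≡ x ⊎ Σ ℕ λ u → u ∈ walk l m k x × at l u ≡ s
  walk-∈⁻ (suc k) {x} s∈ with x ≟ m
  ... | yes x≡m with () ← subst (_ ∈_) (walk-≡ (suc k) x≡m) s∈
  ... | no  x≢m with subst (_ ∈_) (walk-≢ k x≢m) s∈
  ...   | here s≡x = inj₁ s≡x
  ...   | there s∈′ with walk-∈⁻ k s∈′
  ...     | inj₁ s≡πx            = inj₂ (x , in-walk (here refl) , sym s≡πx)
    where in-walk = subst (x ∈_) (sym (walk-≢ k x≢m))
  ...     | inj₂ (u , u∈ , πu≡s) = inj₂ (u , in-walk (there u∈) , πu≡s)
    where in-walk = subst (u ∈_) (sym (walk-≢ k x≢m))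

  -- Without descents every step of the walk is a strict ascent (R-injective rules out
  -- fixed points), and the walk stays below b until it meets m; so it meets m before
  -- the fuel k runs out.
  walk-closes : (R : ℕ → Set) (b : ℕ) →
    (∀ {z} → R z → R (at l z)) →
    (∀ {z} → R z → z ≢ m → z < b) →
    (∀ {u v} → R u → R v → at l u ≡ at l v → u ≡ v) →
    R m → at l m ≢ m → ∀ k → b < k + at l m → Avoids21 (walk l m k (at l m)) →
    ∃₂ λ pre y → walk l m k (at l m) ≡ pre ++ [ y ] × at l y ≡ m
  walk-closes R b R-closed R-bounded R-injective Rm πm≢m k fuel asc =
    go k (R-closed Rm) πm≢m (πm≢m ∘ R-injective (R-closed Rm) Rm) fuel asc
    where
    go : ∀ k {x} → R x → x ≢ m → at l x ≢ x → b < k + x → Avoids21 (walk l m k x) →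
      ∃₂ λ pre y → walk l m k x ≡ pre ++ [ y ] × at l y ≡ m
    go zero Rx x≢m _ b<x _ = ⊥-elim (<-asym (R-bounded Rx x≢m) b<x)
    go (suc k) {x} Rx x≢m πx≢x b<k+x asc with at l x ≟ m | k
    ... | yes πx≡m | k′ =
      [] , x , trans (walk-≢ k′ x≢m) (cong (x ∷_) (walk-≡ k′ πx≡m)) , πx≡m
    ... | no  πx≢m | zero = ⊥-elim (<⇒≱ (R-bounded Rx x≢m) (≤-pred b<k+x))
    ... | no  πx≢m | suc k′ =
      let pre , y , walk≡ , πy≡m =
            go (suc k′) (R-closed Rx) πx≢m πx′≢πx fuel′ (Avoids21-tail asc′)
      in  x ∷ pre , y , trans (walk-≢ (suc k′) x≢m) (cong (x ∷_) walk≡) , πy≡m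
      where
      asc′ : Avoids21 (x ∷ walk l m (suc k′) (at l x))
      asc′ = subst Avoids21 (walk-≢ (suc k′) x≢m) asc
      x<πx : x < at l x
      x<πx = ≤∧≢⇒< (Avoids21-head (subst (Avoids21 ∘ (x ∷_)) (walk-≢ k′ πx≢m) asc′))
                   (πx≢x ∘ sym)
      πx′≢πx : at l (at l x) ≢ at l x
      πx′≢πx = πx≢x ∘ R-injective (R-closed Rx) Rx
      fuel′ : b < suc k′ + at l x
      fuel′ = begin-strict
        b                   <⟨ b<k+x ⟩
        suc (suc k′ + x)    ≡⟨ +-suc (suc k′) x ⟨
        suc k′ + suc x      ≤⟨ +-monoʳ-≤ (suc k′) x<πx ⟩
        suc k′ + at l x     ∎
        where open ≤-Reasoning

θ-block : List ℕ → ℕ → List ℕ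
θ-block l m = if isCycleMax l m then cycleFrom l m else []

θ-block-max : ∀ l m → All (_≤ m) (walk l m (length l) (at l m)) →
  θ-block l m ≡ m ∷ walk l m (length l) (at l m)
θ-block-max l m below rewrite isCycleMax-true l m below = cycleFrom-walk l m

concatMap-oneToN-suc : ∀ (g : ℕ → List ℕ) k →
  concatMap g (oneToN (suc k)) ≡ concatMap g (oneToN k) ++ g (suc k)
concatMap-oneToN-suc g k = begin
  concatMap g (oneToN (suc k))              ≡⟨ cong (concatMap g) (oneToN-suc k) ⟩
  concatMap g (oneToN k ++ [ suc k ])       ≡⟨ concatMap-++ g (oneToN k) [ suc k ] ⟩
  concatMap g (oneToN k) ++ g (suc k) ++ [] ≡⟨ cong (concatMap g (oneToN k) ++_) (++-identityʳ _) ⟩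
  concatMap g (oneToN k) ++ g (suc k)       ∎
  where open ≡-Reasoning

θ-unfold : ∀ l {k} → length l ≡ suc k →
  θ l ≡ concatMap (θ-block l) (oneToN k) ++ θ-block l (suc k)
θ-unfold l {k} len =
  trans (cong (concatMap (θ-block l) ∘ oneToN) len) (concatMap-oneToN-suc (θ-block l) k)

last-fixed⇒reducible : ∀ {k π} → IsPerm (suc k) π → 1 ≤ k → at π (suc k) ≡ suc k →
  Reducible π
last-fixed⇒reducible {π = π} P 1≤k πk≡k with initLast π
... | [] with () ← IsPerm-length P
... | σ ∷ʳ′ a with refl ← suc-injective (trans (sym (length-∷ʳ σ a)) (IsPerm-length P)) =
  σ , [ 1 ] , σ-perm , ↭-refl , σ≢[] , (λ ()) , cong (λ x → σ ++ [ x ]) a≡1+|σ|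
  where
  a≡1+|σ| : a ≡ suc (length σ)
  a≡1+|σ| = trans (sym (at-last σ a)) πk≡k
  σ-perm : IsPerm (length σ) σ
  σ-perm = subst₂ _↭_ (++-identityʳ σ) (++-identityʳ (oneToN (length σ)))
    (drop-mid σ (oneToN (length σ))
      (subst₂ _↭_ (cong (λ x → σ ++ [ x ]) a≡1+|σ|) (oneToN-suc (length σ)) P))
  σ≢[] : σ ≢ []
  σ≢[] σ≡[] with () ← subst (λ τ → 1 ≤ length τ) σ≡[] 1≤k

module _ {n : ℕ} {π : List ℕ} (P : IsPerm n π) (av : Avoids321 π)
         {i : ℕ} (1≤i : 1 ≤ i) (πi≡n : at π i ≡ n) where

  ascending-after-max : ∀ {p q} → i < p → p < q → q ≤ n → at π p < at π q
  ascending-after-max {p} {q} i<p p<q q≤n = ≤∧≢⇒< (≮⇒≥ descent) πp≢πq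
    where
    p≤n : p ≤ n
    p≤n = <⇒≤ (<-≤-trans p<q q≤n)
    i∈ : InRange n i
    i∈ = 1≤i , ≤-trans (<⇒≤ i<p) p≤n
    p∈ : InRange n p
    p∈ = ≤-trans 1≤i (<⇒≤ i<p) , p≤n
    q∈ : InRange n q
    q∈ = ≤-trans (proj₁ p∈) (<⇒≤ p<q) , q≤n
    πp<πi : at π p < at π i
    πp<πi = ≤∧≢⇒< (subst (at π p ≤_) (sym πi≡n) (proj₂ (IsPerm-at-InRange P p∈)))
                  (λ πp≡πi → <-irrefl (IsPerm-at-injective P i∈ p∈ (sym πp≡πi)) i<p)
    descent : ¬ at π q < at π p
    descent = Avoids321-at P av 1≤i i<p p<q q≤n πp<πi
    πp≢πq : at π p ≢ at π q
    πp≢πq πp≡πq = <-irrefl (IsPerm-at-injective P p∈ q∈ πp≡πq) p<q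

  after-max-bound : ∀ {p} → i < p → p ≤ n → p ≤ i + at π p
  after-max-bound {suc p} i<1+p 1+p≤n with m<1+n⇒m<n∨m≡n i<1+p
  ... | inj₂ refl = m<m+n i (proj₁ (IsPerm-at-InRange P (s≤s z≤n , 1+p≤n)))
  ... | inj₁ i<p  = begin
    suc p                ≤⟨ s≤s (after-max-bound i<p (<⇒≤ 1+p≤n)) ⟩
    suc (i + at π p)     ≡⟨ +-suc i (at π p) ⟨
    i + suc (at π p)     ≤⟨ +-monoʳ-≤ i (ascending-after-max i<p ≤-refl 1+p≤n) ⟩
    i + at π (suc p)     ∎
    where open ≤-Reasoning

module Lemma3p11 (j : ℕ) {π : List ℕ} (P : IsPerm (suc (suc j)) π) (irr : Irreducible π)
                 (av : Avoids321 π) (avθ : Avoids321 (θ π)) where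

  n₁ : ℕ
  n₁ = suc j

  n : ℕ
  n = suc n₁

  n₁<n : n₁ < n
  n₁<n = n<1+n n₁

  n∈ : InRange n n
  n∈ = s≤s z≤n , ≤-refl

  πn≢n : at π n ≢ n
  πn≢n = irr ∘ last-fixed⇒reducible P (s≤s z≤n)

  cycleₙ : List ℕ
  cycleₙ = walk π n (length π) (at π n)

  cycleₙ-All : All (λ z → InRange n z × z ≢ n) cycleₙ
  cycleₙ-All = walk-All π n (InRange n) (IsPerm-at-InRange P) (length π) (IsPerm-at-InRange P n∈)

  cycleₙ-InRange : ∀ {z} → z ∈ cycleₙ → InRange n z
  cycleₙ-InRange = proj₁ ∘ All.lookup cycleₙ-All

  cycleₙ-< : All (_< n) cycleₙ
  cycleₙ-< = All.map (λ (z∈ , z≢n) → ≤∧≢⇒< (proj₂ z∈) z≢n) cycleₙ-All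

  cycleₙ-last : ∀ {pre y} → cycleₙ ≡ pre ++ [ y ] → y ∈ cycleₙ
  cycleₙ-last {pre} cyc≡ = subst (_ ∈_) (sym cyc≡) (∈-++⁺ʳ pre (here refl))

  blocks<n₁ : List ℕ
  blocks<n₁ = concatMap (θ-block π) (oneToN j)

  blocks<n : List ℕ
  blocks<n = blocks<n₁ ++ θ-block π n₁

  θπ≡ : θ π ≡ blocks<n ++ n ∷ cycleₙ
  θπ≡ = trans (θ-unfold π (IsPerm-length P))
    (cong₂ _++_ (concatMap-oneToN-suc (θ-block π) j) (θ-block-max π n (All.map <⇒≤ cycleₙ-<)))

  ⊆-θπ : ∀ {xs ys} → xs ⊆ blocks<n → ys ⊆ n ∷ cycleₙ → xs ++ ys ⊆ θ π
  ⊆-θπ xs⊆ ys⊆ = subst (_ ⊆_) (sym θπ≡) (++⁺ xs⊆ ys⊆)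

  cycleₙ-ascending : Avoids21 cycleₙ
  cycleₙ-ascending = Avoids321⇒Avoids21 avθ (⊆-θπ (minimum blocks<n) ⊆-refl) cycleₙ-<

  cycleₙ-closes : ∃₂ λ pre y → cycleₙ ≡ pre ++ [ y ] × at π y ≡ n
  cycleₙ-closes = walk-closes π n (InRange n) n (IsPerm-at-InRange P) (≤∧≢⇒< ∘ proj₂)
    (IsPerm-at-injective P) n∈ πn≢n (length π) fuel cycleₙ-ascending
    where
    fuel : n < length π + at π n
    fuel = subst (λ k → n < k + at π n) (sym (IsPerm-length P))
      (m<m+n n (proj₁ (IsPerm-at-InRange P n∈)))

  module LongCycle {pre y} (cyc≡ : cycleₙ ≡ pre ++ [ y ]) (πy≡n : at π y ≡ n) (y<n₁ : y < n₁)
                   {c₁ c₂ rest} (cyc≡′ : cycleₙ ≡ c₁ ∷ c₂ ∷ rest) where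

    y∈ : y ∈ cycleₙ
    y∈ = cycleₙ-last cyc≡

    below-y : All (_≤ y) cycleₙ
    below-y = subst (All (_≤ y)) (sym cyc≡)
      (Avoids21-last-max pre (subst Avoids21 cyc≡ cycleₙ-ascending))

    c₁∈ : c₁ ∈ cycleₙ
    c₁∈ = subst (c₁ ∈_) (sym cyc≡′) (here refl)

    c₂∈ : c₂ ∈ cycleₙ
    c₂∈ = subst (c₂ ∈_) (sym cyc≡′) (there (here refl))

    c₁≡πn : c₁ ≡ at π n
    c₁≡πn = proj₁ (walk-∷⁻ π n (length π) cyc≡′)

    c₂≡πc₁ : c₂ ≡ at π c₁
    c₂≡πc₁ = let _ , k , tail≡ = walk-∷⁻ π n (length π) cyc≡′
             in  trans (proj₁ (walk-∷⁻ π n k (sym tail≡))) (cong (at π) (sym c₁≡πn))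

    c₁<c₂ : c₁ < c₂
    c₁<c₂ = ≤∧≢⇒< (Avoids21-head (subst Avoids21 cyc≡′ cycleₙ-ascending)) c₁≢c₂
      where
      c₁≢c₂ : c₁ ≢ c₂
      c₁≢c₂ c₁≡c₂ = proj₂ (All.lookup cycleₙ-All c₁∈)
        (IsPerm-at-injective P (cycleₙ-InRange c₁∈) n∈
          (trans (sym c₂≡πc₁) (trans (sym c₁≡c₂) c₁≡πn)))

    c₂<n₁ : c₂ < n₁
    c₂<n₁ = ≤-<-trans (All.lookup below-y c₂∈) y<n₁

    preimage-closed : ∀ {z} → InRange n z → at π z ∈ n ∷ cycleₙ → z ∈ n ∷ cycleₙ
    preimage-closed z∈ (here πz≡n) = there (subst (_∈ cycleₙ) y≡z y∈)
      where
      y≡z = IsPerm-at-injective P (cycleₙ-InRange y∈) z∈ (trans πy≡n (sym πz≡n))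
    preimage-closed z∈ (there πz∈) with walk-∈⁻ π n (length π) πz∈
    ... | inj₁ πz≡πn            = here (IsPerm-at-injective P z∈ n∈ πz≡πn)
    ... | inj₂ (u , u∈ , πu≡πz) = there (subst (_∈ cycleₙ) u≡z u∈)
      where
      u≡z = IsPerm-at-injective P (cycleₙ-InRange u∈) z∈ πu≡πz

    Outside : ℕ → Set
    Outside z = InRange n z × z ∉ n ∷ cycleₙ

    Outside-closed : ∀ {z} → Outside z → Outside (at π z)
    Outside-closed (z∈ , z∉) = IsPerm-at-InRange P z∈ , z∉ ∘ preimage-closed z∈

    Outside-bounded : ∀ {z} → Outside z → z ≢ n₁ → z < n₁
    Outside-bounded (z∈ , z∉) = ≤∧≢⇒< (≤-pred (≤∧≢⇒< (proj₂ z∈) (z∉ ∘ here)))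

    Outside-injective : ∀ {u v} → Outside u → Outside v → at π u ≡ at π v → u ≡ v
    Outside-injective (u∈ , _) (v∈ , _) = IsPerm-at-injective P u∈ v∈

    Outside-n₁ : Outside n₁
    Outside-n₁ = (s≤s z≤n , <⇒≤ n₁<n) , n₁∉
      where
      n₁∉ : n₁ ∉ n ∷ cycleₙ
      n₁∉ (here n₁≡n) = <-irrefl n₁≡n n₁<n
      n₁∉ (there n₁∈) = <⇒≱ y<n₁ (All.lookup below-y n₁∈)

    cycleₙ₁ : List ℕ
    cycleₙ₁ = walk π n₁ (length π) (at π n₁)

    cycleₙ₁-All : All (λ z → Outside z × z ≢ n₁) cycleₙ₁
    cycleₙ₁-All = walk-All π n₁ Outside Outside-closed (length π) (Outside-closed Outside-n₁)

    cycleₙ₁-< : All (_< n₁) cycleₙ₁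
    cycleₙ₁-< = All.map (λ (o , z≢n₁) → Outside-bounded o z≢n₁) cycleₙ₁-All

    cycleₙ₁-⊆-blocks : (n₁ ∷ cycleₙ₁) ⊆ blocks<n
    cycleₙ₁-⊆-blocks = subst ((n₁ ∷ cycleₙ₁) ⊆_)
      (cong (blocks<n₁ ++_) (sym (θ-block-max π n₁ (All.map <⇒≤ cycleₙ₁-<))))
      (++⁺ˡ blocks<n₁ ⊆-refl)

    cycleₙ₁-ascending : Avoids21 cycleₙ₁
    cycleₙ₁-ascending = Avoids321⇒Avoids21 avθ
      (subst ((n₁ ∷ cycleₙ₁) ⊆_) (sym θπ≡) (++⁺ʳ _ cycleₙ₁-⊆-blocks)) cycleₙ₁-<

    πn₁≢n₁ : at π n₁ ≢ n₁
    πn₁≢n₁ πn₁≡n₁ = Avoids321-at P av (proj₁ (cycleₙ-InRange y∈)) y<n₁ n₁<n ≤-refl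
      (subst₂ _<_ (sym πn₁≡n₁) (sym πy≡n) n₁<n)
      (subst₂ _<_ c₁≡πn (sym πn₁≡n₁) (<-trans c₁<c₂ c₂<n₁))

    cycleₙ₁-last-impossible : ∀ {pre₁ d} → cycleₙ₁ ≡ pre₁ ++ [ d ] → at π d ≡ n₁ → ⊥
    cycleₙ₁-last-impossible {pre₁} {d} cyc₁≡ πd≡n₁ = compare (<-cmp d c₁)
      where
      d∈ : d ∈ cycleₙ₁
      d∈ = subst (d ∈_) (sym cyc₁≡) (∈-++⁺ʳ pre₁ (here refl))
      d-Outside : Outside d
      d-Outside = proj₁ (All.lookup cycleₙ₁-All d∈)
      compare : Tri (d < c₁) (d ≡ c₁) (c₁ < d) → ⊥
      compare (tri< d<c₁ _ _) = Avoids321-at P av (proj₁ (proj₁ d-Outside)) d<c₁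
        (<-trans c₁<c₂ (<-trans c₂<n₁ n₁<n)) ≤-refl
        (subst₂ _<_ c₂≡πc₁ (sym πd≡n₁) c₂<n₁)
        (subst₂ _<_ c₁≡πn c₂≡πc₁ c₁<c₂)
      compare (tri≈ _ d≡c₁ _) = proj₂ d-Outside (there (subst (_∈ cycleₙ) (sym d≡c₁) c₁∈))
      compare (tri> _ _ c₁<d) = avθ (n₁ , d , c₁ ,
        ⊆-θπ (⊆-trans (refl ∷ from∈ d∈) cycleₙ₁-⊆-blocks) (n ∷ʳ from∈ c₁∈) ,
        All.lookup cycleₙ₁-< d∈ , c₁<d)

    impossible : ⊥
    impossible =
      let _ , _ , cyc₁≡ , πd≡n₁ = walk-closes π n₁ Outside n₁ Outside-closed Outside-bounded
            Outside-injective Outside-n₁ πn₁≢n₁ (length π) fuel cycleₙ₁-ascending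
      in  cycleₙ₁-last-impossible cyc₁≡ πd≡n₁
      where
      fuel : n₁ < length π + at π n₁
      fuel = subst (λ k → n₁ < k + at π n₁) (sym (IsPerm-length P)) (m≤m+n n (at π n₁))

  EndsInN₁ : Set
  EndsInN₁ = (Σ (List ℕ) λ pre → θ π ≡ pre ++ [ n₁ ]) × at π n₁ ≡ n

  EndsInTwoCycle : Set
  EndsInTwoCycle = Σ ℕ λ i → ⌈ n /2⌉ ≤ i × i ≤ j ×
    (Σ (List ℕ) λ pre → θ π ≡ pre ++ n ∷ i ∷ []) × at π n ≡ i × at π i ≡ n

  ends-in-two-cycle : ∀ pre {y} → cycleₙ ≡ pre ++ [ y ] → at π y ≡ n → y < n₁ →
    EndsInTwoCycle
  ends-in-two-cycle [] {y} cyc≡ πy≡n y<n₁ =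
    y , ⌈n/2⌉≤y , ≤-pred y<n₁ , (blocks<n , θπ≡′) , πn≡y , πy≡n
    where
    θπ≡′ : θ π ≡ blocks<n ++ n ∷ y ∷ []
    θπ≡′ = trans θπ≡ (cong (λ c → blocks<n ++ n ∷ c) cyc≡)
    πn≡y : at π n ≡ y
    πn≡y = sym (proj₁ (walk-∷⁻ π n (length π) cyc≡))
    n≤y+y : n ≤ y + y
    n≤y+y = subst (λ v → n ≤ y + v) πn≡y (after-max-bound P av
      (proj₁ (cycleₙ-InRange (cycleₙ-last {[]} cyc≡))) πy≡n (<-trans y<n₁ n₁<n) ≤-refl)
    ⌈n/2⌉≤y : ⌈ n /2⌉ ≤ y
    ⌈n/2⌉≤y = subst (⌈ n /2⌉ ≤_) (sym (n≡⌈n+n/2⌉ y)) (⌈n/2⌉-mono n≤y+y)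
  ends-in-two-cycle (c₁ ∷ []) cyc≡ πy≡n y<n₁ =
    ⊥-elim (LongCycle.impossible {c₁ ∷ []} cyc≡ πy≡n y<n₁ cyc≡)
  ends-in-two-cycle (c₁ ∷ c₂ ∷ pre) cyc≡ πy≡n y<n₁ =
    ⊥-elim (LongCycle.impossible {c₁ ∷ c₂ ∷ pre} cyc≡ πy≡n y<n₁ cyc≡)

  conclusion : ∀ pre y → cycleₙ ≡ pre ++ [ y ] → at π y ≡ n → EndsInN₁ ⊎ EndsInTwoCycle
  conclusion pre y cyc≡ πy≡n with y ≟ n₁
  ... | yes refl = inj₁ ((blocks<n ++ n ∷ pre , θπ≡′) , πy≡n)
    where
    θπ≡′ : θ π ≡ (blocks<n ++ n ∷ pre) ++ [ n₁ ]
    θπ≡′ = trans θπ≡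
      (trans (cong (λ c → blocks<n ++ n ∷ c) cyc≡) (sym (++-assoc blocks<n (n ∷ pre) [ n₁ ])))
  ... | no y≢n₁ = inj₂ (ends-in-two-cycle pre cyc≡ πy≡n y<n₁)
    where
    y<n₁ : y < n₁
    y<n₁ = ≤∧≢⇒< (≤-pred (All.lookup cycleₙ-< (cycleₙ-last cyc≡))) y≢n₁

lemma3p11 : (n : ℕ) → 2 ≤ n → (π : List ℕ) → IsPerm n π → Irreducible π →
    Avoids321 π → Avoids321 (θ π) →
    ((Σ (List ℕ) λ pre → θ π ≡ pre ++ (n ∸ 1) ∷ []) × at π (n ∸ 1) ≡ n)
    ⊎ (Σ ℕ λ i → ⌈ n /2⌉ ≤ i × i ≤ n ∸ 2 ×
        (Σ (List ℕ) λ pre → θ π ≡ pre ++ n ∷ i ∷ []) × at π n ≡ i × at π i ≡ n)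
lemma3p11 (suc (suc j)) _ π P irr av avθ =
  let pre , y , cyc≡ , πy≡n = cycleₙ-closes in conclusion pre y cyc≡ πy≡n
  where open Lemma3p11 j P irr av avθ
lemma3p11 (suc zero) (s≤s ()) _ _ _ _ _
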